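{- Let $G$ be a formula, $N=|G|$ (number of symbols of $G$) and let $\mathcal D$ be an $\mathbf{FRJ}(G)$-derivation. Then (i) the height of $\mathcal D$ is $O(N^2)$; (ii) if $\mathcal D$ is a derivation of $G$, the height of the Kripke model $\mathrm{Mod}(\mathcal D)$ is at most $N$.
   Context: Formulas are built from a countably infinite set $\mathcal{V}$ of propositional variables and $\bot$ using $\land,\lor,\supset$. Let $\mathcal{V}_\bot=\mathcal{V}\cup\{\bot\}$, $\mathcal{L}^{\supset}$ the set of formulas with main connective $\supset$. For a formula $G$, $\mathrm{Sl}(G)$ and $\mathrm{Sr}(G)$ are the smallest subsets of the subformulas of $G$ with: $G\in\mathrm{Sr}(G)$; $A\land B$ or $A\lor B$ in $\mathrm{Sl}(G)$ (resp. $\mathrm{Sr}(G)$) implies $A,B$ in $\mathrm{Sl}(G)$ (resp. $\mathrm{Sr}(G)$); $A\supset B\in\mathrm{Sl}(G)$ implies $B\in\mathrm{Sl}(G)$, $A\in\mathrm{Sr}(G)$; $A\supset B\in\mathrm{Sr}(G)$ implies $B\in\mathrm{Sr}(G)$, $A\in\mathrm{Sl}(G)$. $\mathrm{Cl}(\Gamma)$ is the smallest set containing $\Gamma$ such that if $X,Y\in\mathrm{Cl}(\Gamma)$ and $A$ is any formula then $X\land Y,A\lor X,X\lor A,A\supset X\in\mathrm{Cl}(\Gamma)$. $\mathbf{FRJ}(G)$: let $\bar\Gamma^{At}=\mathrm{Sl}(G)\cap\mathcal V$, $\bar\Gamma^{\supset}=\mathrm{Sl}(G)\cap\mathcal L^{\supset}$,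 $\bar\Gamma=\bar\Gamma^{At}\cup\bar\Gamma^{\supset}$. Sequents: regular $\Gamma\Rightarrow C$ ($\Gamma\subseteq\bar\Gamma$, $C\in\mathrm{Sr}(G)$), irregular $\Sigma;\Theta\rightarrow C$ ($\Sigma\cup\Theta\subseteq\bar\Gamma$, $C\in\mathrm{Sr}(G)$); $\mathrm{Lhs}$ is $\Gamma$, resp. $\Sigma\cup\Theta$; conclusions always have right formula in $\mathrm{Sr}(G)$. Rules ($F\in\mathcal V_\bot$, $k\in\{1,2\}$): axioms $\bar\Gamma^{At}\setminus\{F\}\Rightarrow F$ and $\emptyset;(\bar\Gamma^{At}\setminus\{F\})\cup\bar\Gamma^{\supset}\rightarrow F$; ($\land$) $\Gamma\Rightarrow A_k/\Gamma\Rightarrow A_1\land A_2$ and $\Sigma;\Theta\rightarrow A_k/\Sigma;\Theta\rightarrow A_1\land A_2$; ($\lor$) $\Sigma_1;\Theta_1\rightarrow C_1$, $\Sigma_2;\Theta_2\rightarrow C_2 / \Sigma_1\cup\Sigma_2;\Theta_1\cap\Theta_2\rightarrow C_1\lor C_2$ if $\Sigma_1\subseteq\Sigma_2\cup\Theta_2$, $\Sigma_2\subseteq\Sigma_1\cup\Theta_1$; ($\supset_\in$) $\Gamma\Rightarrow B/\Gamma\Rightarrow A\supset B$ if $A\in\mathrm{Cl}(\Gamma)$, and $\Sigma;\Theta\cup\Lambda\rightarrow B/\Sigma\cup\Lambda;\Theta\rightarrow A\supset B$ if $\Theta\cap\Lambda=\emptyset$, $A\in\mathrm{Cl}(\Sigma\cup\Lambda)$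 and no $\Lambda'\subsetneq\Lambda$ has $A\in\mathrm{Cl}(\Sigma\cup\Lambda')$; ($\supset_{\notin}$) $\Gamma\Rightarrow B/\emptyset;\Theta\rightarrow A\supset B$ if $\Theta\subseteq\mathrm{Cl}(\Gamma)\cap\bar\Gamma$, $A\in\mathrm{Cl}(\Gamma)\setminus\mathrm{Cl}(\Theta)$ and every $\Theta'$ with $\Theta\subsetneq\Theta'\subseteq\mathrm{Cl}(\Gamma)\cap\bar\Gamma$ has $A\in\mathrm{Cl}(\Theta')$; join rules with premises $\Sigma_j;\Theta_j\rightarrow A_j$ ($1\le j\le n$, $n\ge1$): let $\Upsilon=\{A_1,\dots,A_n\}$, $\Sigma^{At}=\bigcup_j(\Sigma_j\cap\mathcal V)$, $\Sigma^{\supset}=\bigcup_j(\Sigma_j\cap\mathcal L^{\supset})$, $\Theta^{At}=\bigcap_j(\Theta_j\cap\mathcal V)$, $\Theta^{\supset}=\{Y\supset Z\in\bigcap_j(\Theta_j\cap\mathcal L^{\supset}):Y\in\Upsilon\}$, requiring $\Sigma_i\subseteq\Sigma_j\cup\Theta_j$ ($i\ne j$) and ($Y\supset Z\in\Sigma^{\supset}\Rightarrow Y\in\Upsilon$); ($\bowtie^{At}$) conclusion $\Sigma^{At}\cup(\Theta^{At}\setminus\{F\})\cup\Sigma^{\supset}\cup\Theta^{\supset}\Rightarrow F$, $F\in\mathcal V_\bot\setminus\Sigma^{At}$, where each $Y\in\Upsilon$ has some $Y\supset Z\in\mathrm{Sl}(G)$; ($\bowtie^{\lor}$) conclusion $\Sigma^{At}\cup\Theta^{At}\cup\Sigma^{\supset}\cup\Theta^{\supset}\Rightarrow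 C_1\lor C_2$, $\{C_1,C_2\}\subseteq\Upsilon$, where each $Y\in\Upsilon$ has some $Y\supset Z\in\mathrm{Sl}(G)$ or $Y\lor Z\in\mathrm{Sr}(G)$ or $Z\lor Y\in\mathrm{Sr}(G)$. A derivation is a finite tree of sequents built by these rules with axioms at the leaves; a derivation of $G$ is a derivation of some regular sequent $\Gamma\Rightarrow G$. Write $\sigma_1\mapsto_0\sigma_2$ if some rule instance has conclusion $\sigma_2$ and $\sigma_1$ among its premises; $\mapsto$ is its transitive closure and $\mapsto_*$ its reflexive-transitive closure. The height of a sequent $\sigma$ in $\mathcal D$ is $0$ if $\sigma$ is an axiom and otherwise $1+\max$ of the heights of the sequents $\sigma'$ occurring in $\mathcal D$ with $\sigma'\mapsto\sigma$; the height of $\mathcal D$ is the height of its root. For a derivation $\mathcal D$ of $G$, a p-sequent is a regular sequent occurring in $\mathcal D$ that is an axiom or the conclusion of a join rule; $\mathrm{Mod}(\mathcal D)=(P,\le,\rho,V)$ where $P$ is the set of p-sequents of $\mathcal D$, $\sigma_1\le\sigma_2$ iff $\sigma_2\mapsto_*\sigma_1$, $\rho$ is the $\le$-minimum, and $V(\sigma)=\mathrm{Lhs}(\sigma)\cap\mathcal V$. The height of a world of a Kripke model is $0$ if it is maximal and otherwise $1+$ the maximal height of a strictly greater world; the height of the model is the height of its root. -}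

module Defs where

open import Data.Nat using (ℕ; zero; suc; _+_; _*_; _≤_)
open import Data.Fin using (Fin)
open import Data.List using (List; []; _∷_; _++_; map; tabulate)
open import Data.List.Membership.Propositional using (_∈_)
open import Data.List.Relation.Binary.Subset.Propositional using (_⊆_)
open import Data.List.Relation.Unary.All using (All)
open import Data.List.Relation.Unary.Any using (Any)
open import Data.Product using (Σ; ∃; ∃-syntax; _×_; _,_)
open import Data.Sum using (_⊎_)
open import Data.Empty using (⊥)
open import Data.Unit using (⊤)
open import Relation.Nullary using (¬_)
open import Relation.Binary.PropositionalEquality using (_≡_; _≢_)

infixr 7 _∧ᶠ_
infixr 6 _∨ᶠ_
infixr 5 _⊃_

data Fm : Set where
  var   : ℕ → Fm
  bot   : Fm
  _∧ᶠ_  : Fm → Fm → Fm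
  _∨ᶠ_  : Fm → Fm → Fm
  _⊃_   : Fm → Fm → Fm

-- |G| : number of symbols (variables, ⊥ and connectives; no parentheses)
size : Fm → ℕ
size (var _)   = 1
size bot       = 1
size (A ∧ᶠ B)  = suc (size A + size B)
size (A ∨ᶠ B)  = suc (size A + size B)
size (A ⊃ B)   = suc (size A + size B)

IsVar : Fm → Set
IsVar x = ∃[ n ] (x ≡ var n)

IsVarBot : Fm → Set
IsVarBot x = IsVar x ⊎ x ≡ bot

IsImp : Fm → Set
IsImp x = ∃[ A ] ∃[ B ] (x ≡ A ⊃ B)

data Sl (G : Fm) : Fm → Set
data Sr (G : Fm) : Fm → Set

data Sl G where
  sl-∧₁ : ∀ {A B} → Sl G (A ∧ᶠ B) → Sl G A
  sl-∧₂ : ∀ {A B} → Sl G (A ∧ᶠ B) → Sl G B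
  sl-∨₁ : ∀ {A B} → Sl G (A ∨ᶠ B) → Sl G A
  sl-∨₂ : ∀ {A B} → Sl G (A ∨ᶠ B) → Sl G B
  sl-⊃  : ∀ {A B} → Sl G (A ⊃ B) → Sl G B
  sr-⊃  : ∀ {A B} → Sr G (A ⊃ B) → Sl G A

data Sr G where
  top   : Sr G G
  sr-∧₁ : ∀ {A B} → Sr G (A ∧ᶠ B) → Sr G A
  sr-∧₂ : ∀ {A B} → Sr G (A ∧ᶠ B) → Sr G B
  sr-∨₁ : ∀ {A B} → Sr G (A ∨ᶠ B) → Sr G A
  sr-∨₂ : ∀ {A B} → Sr G (A ∨ᶠ B) → Sr G B
  sr-⊃  : ∀ {A B} → Sr G (A ⊃ B) → Sr G B
  sl-⊃  : ∀ {A B} → Sl G (A ⊃ B) → Sr G A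

GAt : Fm → Fm → Set
GAt G x = Sl G x × IsVar x

GImp : Fm → Fm → Set
GImp G x = Sl G x × IsImp x

GBar : Fm → Fm → Set
GBar G x = GAt G x ⊎ GImp G x

data Cl (P : Fm → Set) : Fm → Set where
  base : ∀ {X} → P X → Cl P X
  cl-∧ : ∀ {X Y} → Cl P X → Cl P Y → Cl P (X ∧ᶠ Y)
  cl-∨ʳ : ∀ {X} (A : Fm) → Cl P X → Cl P (A ∨ᶠ X)
  cl-∨ˡ : ∀ {X} (A : Fm) → Cl P X → Cl P (X ∨ᶠ A)
  cl-⊃ : ∀ {X} (A : Fm) → Cl P X → Cl P (A ⊃ X)

-- Finite sets of formulas are represented by lists, up to membership.

InL : List Fm → Fm → Set
InL L x = x ∈ L

_≐_ : List Fm → (Fm → Set) → Set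
L ≐ P = ∀ x → (x ∈ L → P x) × (P x → x ∈ L)

_⊆ₚ_ : List Fm → (Fm → Set) → Set
L ⊆ₚ P = ∀ {x} → x ∈ L → P x

_⊊_ : List Fm → List Fm → Set
L ⊊ M = L ⊆ M × ¬ (M ⊆ L)

SameSet : List Fm → List Fm → Set
SameSet L M = L ⊆ M × M ⊆ L

data Seq : Set where
  reg : List Fm → Fm → Seq
  irr : List Fm → List Fm → Fm → Seq

Lhs : Seq → List Fm
Lhs (reg Γ _)   = Γ
Lhs (irr Σ Θ _) = Σ ++ Θ

Rhs : Seq → Fm
Rhs (reg _ C)   = C
Rhs (irr _ _ C) = C

IsRegular : Seq → Set
IsRegular (reg _ _)   = ⊤
IsRegular (irr _ _ _) = ⊥

_≈S_ : Seq → Seq → Set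
reg Γ C ≈S reg Γ' C' = SameSet Γ Γ' × C ≡ C'
irr Σ₁ Θ C ≈S irr Σ₁' Θ' C' = SameSet Σ₁ Σ₁' × SameSet Θ Θ' × C ≡ C'
_ ≈S _ = ⊥

-- σ is a sequent of FRJ(G)
WF : Fm → Seq → Set
WF G σ = (Lhs σ ⊆ₚ GBar G) × Sr G (Rhs σ)

-- Join rules of FRJ(G): premises Σⱼ ; Θⱼ → Aⱼ, j : Fin (suc m)  (n = suc m ≥ 1)

module JoinData {m : ℕ} (Σs Θs : Fin (suc m) → List Fm) (As : Fin (suc m) → Fm) where

  premises : List Seq
  premises = tabulate (λ j → irr (Σs j) (Θs j) (As j))

  Υ : Fm → Set
  Υ y = ∃[ j ] (As j ≡ y)

  ΣAt : Fm → Set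
  ΣAt x = (∃[ j ] (x ∈ Σs j)) × IsVar x

  ΣImp : Fm → Set
  ΣImp x = (∃[ j ] (x ∈ Σs j)) × IsImp x

  ΘAt : Fm → Set
  ΘAt x = (∀ j → x ∈ Θs j) × IsVar x

  ΘImp : Fm → Set
  ΘImp x = (∀ j → x ∈ Θs j) × (∃[ Y ] ∃[ Z ] (x ≡ Y ⊃ Z × Υ Y))

  JoinCond : Set
  JoinCond = (∀ i j → i ≢ j → Σs i ⊆ (Σs j ++ Θs j))
           × (∀ Y Z → ΣImp (Y ⊃ Z) → Υ Y)

data JoinRule (G : Fm) : List Seq → Seq → Set where
  join-at : ∀ {m} (Σs Θs : Fin (suc m) → List Fm) (As : Fin (suc m) → Fm)
    (Γ : List Fm) (F : Fm) →
    let open JoinData Σs Θs As in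
    JoinCond →
    IsVarBot F → ¬ ΣAt F →
    (∀ Y → Υ Y → ∃[ Z ] Sl G (Y ⊃ Z)) →
    Γ ≐ (λ x → ΣAt x ⊎ (ΘAt x × x ≢ F) ⊎ ΣImp x ⊎ ΘImp x) →
    JoinRule G premises (reg Γ F)
  join-or : ∀ {m} (Σs Θs : Fin (suc m) → List Fm) (As : Fin (suc m) → Fm)
    (Γ : List Fm) (C₁ C₂ : Fm) →
    let open JoinData Σs Θs As in
    JoinCond →
    Υ C₁ → Υ C₂ →
    (∀ Y → Υ Y → ∃[ Z ] (Sl G (Y ⊃ Z) ⊎ Sr G (Y ∨ᶠ Z) ⊎ Sr G (Z ∨ᶠ Y))) →
    Γ ≐ (λ x → ΣAt x ⊎ ΘAt x ⊎ ΣImp x ⊎ ΘImp x) →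
    JoinRule G premises (reg Γ (C₁ ∨ᶠ C₂))

-- Rules of FRJ(G) (premise list, conclusion); side conditions on being
-- sequents of FRJ(G) are added in RuleInst below.

data Rule (G : Fm) : List Seq → Seq → Set where
  ax-reg : ∀ (Γ : List Fm) (F : Fm) → IsVarBot F →
    Γ ≐ (λ x → GAt G x × x ≢ F) →
    Rule G [] (reg Γ F)
  ax-irr : ∀ (Θ : List Fm) (F : Fm) → IsVarBot F →
    Θ ≐ (λ x → (GAt G x × x ≢ F) ⊎ GImp G x) →
    Rule G [] (irr [] Θ F)
  ∧₁-reg : ∀ Γ A₁ A₂ → Rule G (reg Γ A₁ ∷ []) (reg Γ (A₁ ∧ᶠ A₂))
  ∧₂-reg : ∀ Γ A₁ A₂ → Rule G (reg Γ A₂ ∷ []) (reg Γ (A₁ ∧ᶠ A₂))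
  ∧₁-irr : ∀ Σ₁ Θ A₁ A₂ → Rule G (irr Σ₁ Θ A₁ ∷ []) (irr Σ₁ Θ (A₁ ∧ᶠ A₂))
  ∧₂-irr : ∀ Σ₁ Θ A₁ A₂ → Rule G (irr Σ₁ Θ A₂ ∷ []) (irr Σ₁ Θ (A₁ ∧ᶠ A₂))
  ∨-irr : ∀ Σ₁ Θ₁ C₁ Σ₂ Θ₂ C₂ (Σ₀ Θ₀ : List Fm) →
    Σ₁ ⊆ (Σ₂ ++ Θ₂) → Σ₂ ⊆ (Σ₁ ++ Θ₁) →
    Σ₀ ≐ (λ x → x ∈ Σ₁ ⊎ x ∈ Σ₂) →
    Θ₀ ≐ (λ x → x ∈ Θ₁ × x ∈ Θ₂) →
    Rule G (irr Σ₁ Θ₁ C₁ ∷ irr Σ₂ Θ₂ C₂ ∷ []) (irr Σ₀ Θ₀ (C₁ ∨ᶠ C₂))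
  ⊃∈-reg : ∀ Γ A B → Cl (InL Γ) A → Rule G (reg Γ B ∷ []) (reg Γ (A ⊃ B))
  ⊃∈-irr : ∀ Σ₁ Θ Λ Θ' Σ' A B →
    Θ' ≐ (λ x → x ∈ Θ ⊎ x ∈ Λ) →
    (∀ x → x ∈ Θ → x ∈ Λ → ⊥) →
    Cl (InL (Σ₁ ++ Λ)) A →
    (∀ Λ' → Λ' ⊊ Λ → ¬ Cl (InL (Σ₁ ++ Λ')) A) →
    Σ' ≐ (λ x → x ∈ Σ₁ ⊎ x ∈ Λ) →
    Rule G (irr Σ₁ Θ' B ∷ []) (irr Σ' Θ (A ⊃ B))
  ⊃∉ : ∀ Γ Θ A B →
    Θ ⊆ₚ (λ x → Cl (InL Γ) x × GBar G x) →
    Cl (InL Γ) A → ¬ Cl (InL Θ) A →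
    (∀ Θ' → Θ ⊊ Θ' → Θ' ⊆ₚ (λ x → Cl (InL Γ) x × GBar G x) → Cl (InL Θ') A) →
    Rule G (reg Γ B ∷ []) (irr [] Θ (A ⊃ B))
  join : ∀ {ps σ} → JoinRule G ps σ → Rule G ps σ

RuleInst : Fm → List Seq → Seq → Set
RuleInst G ps σ = Rule G ps σ × All (WF G) ps × WF G σ

IsAxiom : Fm → Seq → Set
IsAxiom G σ = ∃[ σ' ] (RuleInst G [] σ' × σ ≈S σ')

Step : Fm → Seq → Seq → Set
Step G σ₁ σ₂ = ∃[ ps ] ∃[ σ₂' ] (RuleInst G ps σ₂' × σ₂ ≈S σ₂' × Any (σ₁ ≈S_) ps)

data Reach (G : Fm) : Seq → Seq → Set where
  [_]  : ∀ {σ₁ σ₂} → Step G σ₁ σ₂ → Reach G σ₁ σ₂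
  _∷ʳ_ : ∀ {σ₁ σ₂ σ₃} → Reach G σ₁ σ₂ → Step G σ₂ σ₃ → Reach G σ₁ σ₃

Reach* : Fm → Seq → Seq → Set
Reach* G σ₁ σ₂ = σ₁ ≈S σ₂ ⊎ Reach G σ₁ σ₂

data Tree : Set where
  node : Seq → List Tree → Tree

root : Tree → Seq
root (node σ _) = σ

Valid : Fm → Tree → Set
ValidAll : Fm → List Tree → Set
Valid G (node σ ts) = RuleInst G (map root ts) σ × ValidAll G ts
ValidAll G [] = ⊤
ValidAll G (t ∷ ts) = Valid G t × ValidAll G ts

Occurs : Seq → Tree → Set
OccursAny : Seq → List Tree → Set
Occurs σ (node σ' ts) = σ ≈S σ' ⊎ OccursAny σ ts
OccursAny σ [] = ⊥
OccursAny σ (t ∷ ts) = Occurs σ t ⊎ OccursAny σ ts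

JoinOcc : Fm → Seq → Tree → Set
JoinOccAny : Fm → Seq → List Tree → Set
JoinOcc G σ (node σ' ts) = (σ ≈S σ' × JoinRule G (map root ts) σ') ⊎ JoinOccAny G σ ts
JoinOccAny G σ [] = ⊥
JoinOccAny G σ (t ∷ ts) = JoinOcc G σ t ⊎ JoinOccAny G σ ts

-- Height of a sequent in 𝒟: HChain G D k σ  holds iff there is a chain
-- σ₀ ↦ σ₁ ↦ ⋯ ↦ σₖ = σ of sequents occurring in 𝒟 with σ₁,…,σₖ not axioms.
-- The height of σ is the supremum of such k.

data HChain (G : Fm) (D : Tree) : ℕ → Seq → Set where
  start : ∀ {σ} → Occurs σ D → HChain G D 0 σ
  step  : ∀ {k σ σ'} → HChain G D k σ → Reach G σ σ' → Occurs σ' D →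
          ¬ IsAxiom G σ' → HChain G D (suc k) σ'

HeightLe : Fm → Tree → ℕ → Set
HeightLe G D h = ∀ k → HChain G D k (root D) → k ≤ h

PSeq : Fm → Tree → Seq → Set
PSeq G D σ = IsRegular σ × Occurs σ D × (IsAxiom G σ ⊎ JoinOcc G σ D)

_≤[_]_ : Seq → Fm → Seq → Set
σ₁ ≤[ G ] σ₂ = Reach* G σ₂ σ₁

_<[_]_ : Seq → Fm → Seq → Set
σ₁ <[ G ] σ₂ = σ₁ ≤[ G ] σ₂ × ¬ (σ₁ ≈S σ₂)

IsModRoot : Fm → Tree → Seq → Set
IsModRoot G D ρ = PSeq G D ρ × (∀ σ → PSeq G D σ → ρ ≤[ G ] σ)

data WChain (G : Fm) (D : Tree) (ρ : Seq) : ℕ → Seq → Set where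
  start : WChain G D ρ 0 ρ
  step  : ∀ {k w w'} → WChain G D ρ k w → PSeq G D w' → w <[ G ] w' →
          WChain G D ρ (suc k) w'

ModHeightLe : Fm → Tree → ℕ → Set
ModHeightLe G D h = ∀ ρ → IsModRoot G D ρ → ∀ k w → WChain G D ρ k w → k ≤ h

IsDerivationOf : Fm → Tree → Set
IsDerivationOf G D = ∃[ Γ ] (root D ≡ reg Γ G)

-- Let c(σ) be the number of subformulas of G lying in Cl(Lhs σ).  Passing from
-- a premise to the conclusion of a rule of FRJ(G) never increases c; the only
-- rule leading from a regular to an irregular sequent, (⊃∉), decreases it
-- strictly, and every other rule either keeps the kind of sequent and enlarges
-- the right formula, or concludes a regular sequent from an irregular premise.
-- So the lexicographic potential (N − c, kind, size of the right formula), which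
-- takes O(N²) values, strictly increases along every chain σ₀ ↦ σ₁ ↦ ⋯.
-- A p-sequent is regular with an atomic or disjunctive right formula, and such
-- a sequent is only concluded from irregular premises.  Hence every path from a
-- p-sequent down to a smaller one passes a (⊃∉) step, c strictly increases along
-- a chain of worlds, and c ≤ N bounds its length.
module Submission where

open import Defs
open import Data.Nat using (ℕ; suc; _+_; _*_; _∸_; _≤_; _<_; z≤n; s≤s; z<s; _≟_)
open import Data.Nat.Properties
open import Data.Nat.Tactic.RingSolver using (solve-∀)
open import Data.Fin using (Fin) renaming (_≟_ to _≟ᶠⁱⁿ_)
open import Data.List using (List; []; _∷_; _++_; length; filter)
open import Data.List.Properties using (length-++; length-filter)
open import Data.List.Membership.Propositional using (_∈_; find)
open import Data.List.Membership.Propositional.Properties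
  using (∈-++⁺ˡ; ∈-++⁺ʳ; ∈-++⁻; ∈-tabulate⁻; ∈-filter⁺; ∈-filter⁻)
open import Data.List.Relation.Binary.Subset.Propositional using (_⊆_)
open import Data.List.Relation.Binary.Subset.Propositional.Properties using (++⁺)
open import Data.List.Relation.Binary.Sublist.Propositional.Properties
  using (filter⁺; length-mono-≤; to-≋)
open import Data.List.Relation.Binary.Sublist.Propositional
  using (⊆-refl) renaming (_⊆_ to Sublist)
open import Data.List.Relation.Binary.Pointwise using (Pointwise-≡⇒≡)
open import Data.List.Relation.Unary.All as All using (All)
open import Data.List.Relation.Unary.Any using (here; there)
open import Data.Product using (∃-syntax; _×_; _,_; proj₁; proj₂; uncurry)
open import Data.Sum using (_⊎_; inj₁; inj₂; [_,_]′; swap)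
open import Data.Empty using (⊥; ⊥-elim)
open import Data.Unit using (⊤; tt)
open import Function using (_∘_; id)
open import Relation.Nullary using (¬_; yes; no)
open import Relation.Nullary.Decidable using (map′; _×-dec_; _⊎-dec_)
open import Relation.Unary using (Decidable)
open import Relation.Binary.Definitions using (DecidableEquality)
open import Relation.Binary.PropositionalEquality
  using (_≡_; _≢_; refl; sym; trans; cong; cong₂; subst; subst₂)

module _ {A : Set} {P Q : A → Set} (P? : Decidable P) (Q? : Decidable Q)
         (P⇒Q : ∀ {x} → P x → Q x) where

  filter-sublist : ∀ xs → Sublist (filter P? xs) (filter Q? xs)
  filter-sublist xs = filter⁺ P? Q? (λ { refl → P⇒Q }) (⊆-refl {x = xs})

  length-filter-mono : ∀ xs → length (filter P? xs) ≤ length (filter Q? xs)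
  length-filter-mono xs = length-mono-≤ (filter-sublist xs)

  length-filter-mono-< : ∀ {a} xs → a ∈ xs → Q a → ¬ P a →
                         length (filter P? xs) < length (filter Q? xs)
  length-filter-mono-< {a} xs a∈xs Qa ¬Pa = ≤∧≢⇒< (length-filter-mono xs) lengths≢
    where
    lengths≢ : length (filter P? xs) ≢ length (filter Q? xs)
    lengths≢ eq = ¬Pa (proj₂ (∈-filter⁻ P? {xs = xs} a∈filterP))
      where
      a∈filterP : a ∈ filter P? xs
      a∈filterP = subst (a ∈_) (sym (Pointwise-≡⇒≡ (to-≋ eq (filter-sublist xs))))
                        (∈-filter⁺ Q? a∈xs Qa)

++-⊆ : ∀ {A : Set} {xs ys zs : List A} → xs ⊆ zs → ys ⊆ zs → xs ++ ys ⊆ zs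
++-⊆ {xs = xs} xs⊆zs ys⊆zs x∈ = [ xs⊆zs , ys⊆zs ]′ (∈-++⁻ xs x∈)

lex-<ˡ : ∀ {K a b c d} → b < K → a < c → a * K + b < c * K + d
lex-<ˡ {K} {a} {b} {c} {d} b<K a<c = begin-strict
  a * K + b  <⟨ +-monoʳ-< (a * K) b<K ⟩
  a * K + K  ≡⟨ +-comm (a * K) K ⟩
  suc a * K  ≤⟨ *-monoˡ-≤ K a<c ⟩
  c * K      ≤⟨ m≤m+n (c * K) d ⟩
  c * K + d  ∎
  where open ≤-Reasoning

lex-<ʳ : ∀ {K a b c d} → a ≤ c → b < d → a * K + b < c * K + d
lex-<ʳ {K} a≤c b<d = +-mono-≤-< (*-monoˡ-≤ K a≤c) b<d

quadratic-bound : ∀ {N} → 1 ≤ N → suc N * suc (suc (N + N)) ≤ 8 * N * N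
quadratic-bound {suc n} _ = begin
  suc (suc n) * suc (suc (suc n + suc n))                        ≤⟨ m≤m+n _ (6 * n * n + 8 * n) ⟩
  suc (suc n) * suc (suc (suc n + suc n)) + (6 * n * n + 8 * n)  ≡⟨ expand n ⟩
  8 * suc n * suc n                                              ∎
  where
  open ≤-Reasoning
  expand : ∀ n → suc (suc n) * suc (suc (suc n + suc n)) + (6 * n * n + 8 * n)
                 ≡ 8 * suc n * suc n
  expand = solve-∀

_≟ᶠ_ : DecidableEquality Fm
var m ≟ᶠ var n = map′ (cong var) (λ { refl → refl }) (m ≟ n)
bot ≟ᶠ bot = yes refl
(A ∧ᶠ B) ≟ᶠ (C ∧ᶠ D) =
  map′ (λ { (refl , refl) → refl }) (λ { refl → refl , refl }) (A ≟ᶠ C ×-dec B ≟ᶠ D)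
(A ∨ᶠ B) ≟ᶠ (C ∨ᶠ D) =
  map′ (λ { (refl , refl) → refl }) (λ { refl → refl , refl }) (A ≟ᶠ C ×-dec B ≟ᶠ D)
(A ⊃ B) ≟ᶠ (C ⊃ D) =
  map′ (λ { (refl , refl) → refl }) (λ { refl → refl , refl }) (A ≟ᶠ C ×-dec B ≟ᶠ D)
var _ ≟ᶠ bot = no λ ()
var _ ≟ᶠ (_ ∧ᶠ _) = no λ ()
var _ ≟ᶠ (_ ∨ᶠ _) = no λ ()
var _ ≟ᶠ (_ ⊃ _) = no λ ()
bot ≟ᶠ var _ = no λ ()
bot ≟ᶠ (_ ∧ᶠ _) = no λ ()
bot ≟ᶠ (_ ∨ᶠ _) = no λ ()
bot ≟ᶠ (_ ⊃ _) = no λ ()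
(_ ∧ᶠ _) ≟ᶠ var _ = no λ ()
(_ ∧ᶠ _) ≟ᶠ bot = no λ ()
(_ ∧ᶠ _) ≟ᶠ (_ ∨ᶠ _) = no λ ()
(_ ∧ᶠ _) ≟ᶠ (_ ⊃ _) = no λ ()
(_ ∨ᶠ _) ≟ᶠ var _ = no λ ()
(_ ∨ᶠ _) ≟ᶠ bot = no λ ()
(_ ∨ᶠ _) ≟ᶠ (_ ∧ᶠ _) = no λ ()
(_ ∨ᶠ _) ≟ᶠ (_ ⊃ _) = no λ ()
(_ ⊃ _) ≟ᶠ var _ = no λ ()
(_ ⊃ _) ≟ᶠ bot = no λ ()
(_ ⊃ _) ≟ᶠ (_ ∧ᶠ _) = no λ ()
(_ ⊃ _) ≟ᶠ (_ ∨ᶠ _) = no λ ()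

open import Data.List.Membership.DecPropositional _≟ᶠ_ using (_∈?_)

Cl? : (L : List Fm) → Decidable (Cl (InL L))
Cl? L X with X ∈? L
Cl? L X | yes X∈L = yes (base X∈L)
Cl? L (var _) | no X∉L = no λ { (base X∈L) → X∉L X∈L }
Cl? L bot | no X∉L = no λ { (base X∈L) → X∉L X∈L }
Cl? L (A ∧ᶠ B) | no X∉L = map′ (uncurry cl-∧)
  (λ { (base X∈L) → ⊥-elim (X∉L X∈L) ; (cl-∧ a b) → a , b })
  (Cl? L A ×-dec Cl? L B)
Cl? L (A ∨ᶠ B) | no X∉L = map′ [ cl-∨ˡ B , cl-∨ʳ A ]′
  (λ { (base X∈L) → ⊥-elim (X∉L X∈L) ; (cl-∨ˡ _ a) → inj₁ a ; (cl-∨ʳ _ b) → inj₂ b })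
  (Cl? L A ⊎-dec Cl? L B)
Cl? L (A ⊃ B) | no X∉L = map′ (cl-⊃ A)
  (λ { (base X∈L) → ⊥-elim (X∉L X∈L) ; (cl-⊃ _ b) → b })
  (Cl? L B)

infix 4 _⊆Cl_

_⊆Cl_ : List Fm → List Fm → Set
L ⊆Cl M = ∀ {x} → x ∈ L → Cl (InL M) x

⊆⇒⊆Cl : ∀ {L M} → L ⊆ M → L ⊆Cl M
⊆⇒⊆Cl L⊆M = base ∘ L⊆M

Cl-mono : ∀ {L M X} → L ⊆Cl M → Cl (InL L) X → Cl (InL M) X
Cl-mono L⊆M (base x∈L) = L⊆M x∈L
Cl-mono L⊆M (cl-∧ a b) = cl-∧ (Cl-mono L⊆M a) (Cl-mono L⊆M b)
Cl-mono L⊆M (cl-∨ʳ A a) = cl-∨ʳ A (Cl-mono L⊆M a)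
Cl-mono L⊆M (cl-∨ˡ A a) = cl-∨ˡ A (Cl-mono L⊆M a)
Cl-mono L⊆M (cl-⊃ A a) = cl-⊃ A (Cl-mono L⊆M a)

subs : Fm → List Fm
properSubs : Fm → List Fm
subs A = A ∷ properSubs A
properSubs (var _) = []
properSubs bot = []
properSubs (A ∧ᶠ B) = subs A ++ subs B
properSubs (A ∨ᶠ B) = subs A ++ subs B
properSubs (A ⊃ B) = subs A ++ subs B

length-subs : ∀ A → length (subs A) ≡ size A
length-subs-++ : ∀ A B → length (subs A ++ subs B) ≡ size A + size B
length-subs (var _) = refl
length-subs bot = refl
length-subs (A ∧ᶠ B) = cong suc (length-subs-++ A B)
length-subs (A ∨ᶠ B) = cong suc (length-subs-++ A B)
length-subs (A ⊃ B) = cong suc (length-subs-++ A B)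
length-subs-++ A B = trans (length-++ (subs A)) (cong₂ _+_ (length-subs A) (length-subs B))

subs-size : ∀ {A X} → X ∈ subs A → size X ≤ size A
subs-size-++ : ∀ A B {X} → X ∈ subs A ++ subs B → size X ≤ size A + size B
subs-size (here refl) = ≤-refl
subs-size {A ∧ᶠ B} (there X∈) = m≤n⇒m≤1+n (subs-size-++ A B X∈)
subs-size {A ∨ᶠ B} (there X∈) = m≤n⇒m≤1+n (subs-size-++ A B X∈)
subs-size {A ⊃ B} (there X∈) = m≤n⇒m≤1+n (subs-size-++ A B X∈)
subs-size-++ A B X∈ with ∈-++⁻ (subs A) X∈
... | inj₁ X∈A = ≤-trans (subs-size X∈A) (m≤m+n (size A) (size B))
... | inj₂ X∈B = ≤-trans (subs-size X∈B) (m≤n+m (size B) (size A))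

subs-trans : ∀ {A X Y} → X ∈ subs A → Y ∈ subs X → Y ∈ subs A
subs-trans-++ : ∀ A B {X Y} → X ∈ subs A ++ subs B → Y ∈ subs X → Y ∈ subs A ++ subs B
subs-trans (here refl) Y∈X = Y∈X
subs-trans {A ∧ᶠ B} (there X∈) Y∈X = there (subs-trans-++ A B X∈ Y∈X)
subs-trans {A ∨ᶠ B} (there X∈) Y∈X = there (subs-trans-++ A B X∈ Y∈X)
subs-trans {A ⊃ B} (there X∈) Y∈X = there (subs-trans-++ A B X∈ Y∈X)
subs-trans-++ A B X∈ Y∈X with ∈-++⁻ (subs A) X∈
... | inj₁ X∈A = ∈-++⁺ˡ (subs-trans X∈A Y∈X)
... | inj₂ X∈B = ∈-++⁺ʳ (subs A) (subs-trans X∈B Y∈X)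

private
  right∈subs : ∀ A {B} → B ∈ subs A ++ subs B
  right∈subs A = ∈-++⁺ʳ (subs A) (here refl)

Sl⇒∈subs : ∀ {G X} → Sl G X → X ∈ subs G
Sr⇒∈subs : ∀ {G X} → Sr G X → X ∈ subs G
Sl⇒∈subs (sl-∧₁ p) = subs-trans (Sl⇒∈subs p) (there (here refl))
Sl⇒∈subs (sl-∧₂ p) = subs-trans (Sl⇒∈subs p) (there (right∈subs _))
Sl⇒∈subs (sl-∨₁ p) = subs-trans (Sl⇒∈subs p) (there (here refl))
Sl⇒∈subs (sl-∨₂ p) = subs-trans (Sl⇒∈subs p) (there (right∈subs _))
Sl⇒∈subs (sl-⊃ p) = subs-trans (Sl⇒∈subs p) (there (right∈subs _))
Sl⇒∈subs (sr-⊃ p) = subs-trans (Sr⇒∈subs p) (there (here refl))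
Sr⇒∈subs top = here refl
Sr⇒∈subs (sr-∧₁ p) = subs-trans (Sr⇒∈subs p) (there (here refl))
Sr⇒∈subs (sr-∧₂ p) = subs-trans (Sr⇒∈subs p) (there (right∈subs _))
Sr⇒∈subs (sr-∨₁ p) = subs-trans (Sr⇒∈subs p) (there (here refl))
Sr⇒∈subs (sr-∨₂ p) = subs-trans (Sr⇒∈subs p) (there (right∈subs _))
Sr⇒∈subs (sr-⊃ p) = subs-trans (Sr⇒∈subs p) (there (right∈subs _))
Sr⇒∈subs (sl-⊃ p) = subs-trans (Sl⇒∈subs p) (there (here refl))

Sr⇒size-≤ : ∀ {G X} → Sr G X → size X ≤ size G
Sr⇒size-≤ = subs-size ∘ Sr⇒∈subs

1≤size : ∀ A → 1 ≤ size A
1≤size A = subst (1 ≤_) (length-subs A) (s≤s z≤n)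

IsIrregular : Seq → Set
IsIrregular (reg _ _) = ⊥
IsIrregular (irr _ _ _) = ⊤

AtomicOrDisjunction : Fm → Set
AtomicOrDisjunction C = IsVarBot C ⊎ ∃[ C₁ ] ∃[ C₂ ] (C ≡ C₁ ∨ᶠ C₂)

¬AtomicOrDisjunction-∧ : ∀ {A B} → ¬ AtomicOrDisjunction (A ∧ᶠ B)
¬AtomicOrDisjunction-∧ (inj₁ (inj₁ (_ , ())))
¬AtomicOrDisjunction-∧ (inj₁ (inj₂ ()))
¬AtomicOrDisjunction-∧ (inj₂ (_ , _ , ()))

¬AtomicOrDisjunction-⊃ : ∀ {A B} → ¬ AtomicOrDisjunction (A ⊃ B)
¬AtomicOrDisjunction-⊃ (inj₁ (inj₁ (_ , ())))
¬AtomicOrDisjunction-⊃ (inj₁ (inj₂ ()))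
¬AtomicOrDisjunction-⊃ (inj₂ (_ , _ , ()))

PShaped : Seq → Set
PShaped (reg _ C) = AtomicOrDisjunction C
PShaped (irr _ _ _) = ⊥

regular⇒¬irregular : ∀ {σ} → IsRegular σ → ¬ IsIrregular σ
regular⇒¬irregular {reg _ _} _ ()

≈S-sym : ∀ {σ τ} → σ ≈S τ → τ ≈S σ
≈S-sym {reg _ _} {reg _ _} ((Γ⊆Δ , Δ⊆Γ) , C≡D) = (Δ⊆Γ , Γ⊆Δ) , sym C≡D
≈S-sym {irr _ _ _} {irr _ _ _} ((S⊆S′ , S′⊆S) , (T⊆T′ , T′⊆T) , C≡D) =
  (S′⊆S , S⊆S′) , (T′⊆T , T⊆T′) , sym C≡D

≈S-lhs : ∀ {σ τ} → σ ≈S τ → Lhs σ ⊆ Lhs τ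
≈S-lhs {reg _ _} {reg _ _} ((Γ⊆Δ , _) , _) = Γ⊆Δ
≈S-lhs {irr _ _ _} {irr _ _ _} ((S⊆S′ , _) , (T⊆T′ , _) , _) = ++⁺ S⊆S′ T⊆T′

≈S-rhs : ∀ {σ τ} → σ ≈S τ → Rhs σ ≡ Rhs τ
≈S-rhs {reg _ _} {reg _ _} (_ , C≡D) = C≡D
≈S-rhs {irr _ _ _} {irr _ _ _} (_ , _ , C≡D) = C≡D

≈S-regular : ∀ {σ τ} → σ ≈S τ → IsRegular σ → IsRegular τ
≈S-regular {reg _ _} {reg _ _} _ _ = tt

≈S-irregular : ∀ {σ τ} → σ ≈S τ → IsIrregular σ → IsIrregular τ
≈S-irregular {irr _ _ _} {irr _ _ _} _ _ = tt

≈S-pshaped : ∀ {σ τ} → σ ≈S τ → PShaped σ → PShaped τ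
≈S-pshaped {reg _ _} {reg _ _} (_ , refl) shaped = shaped

∨-irr-lhs : ∀ {Σ₀ Θ₀ Σ₁ Θ₁ Σ₂ : List Fm} → Σ₂ ⊆ Σ₁ ++ Θ₁ →
            (∀ {x} → x ∈ Σ₀ → x ∈ Σ₁ ⊎ x ∈ Σ₂) → Θ₀ ⊆ Θ₁ →
            Σ₀ ++ Θ₀ ⊆ Σ₁ ++ Θ₁
∨-irr-lhs {Σ₁ = Σ₁} {Θ₁} Σ₂⊆ Σ₀⊆Σ₁∪Σ₂ Θ₀⊆Θ₁ =
  ++-⊆ ([ ∈-++⁺ˡ , Σ₂⊆ ]′ ∘ Σ₀⊆Σ₁∪Σ₂) (∈-++⁺ʳ Σ₁ ∘ Θ₀⊆Θ₁)

⊃∈-irr-lhs : ∀ {Σ₁ Θ Λ Θ′ Σ′ : List Fm} →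
             Θ′ ≐ (λ x → x ∈ Θ ⊎ x ∈ Λ) → Σ′ ≐ (λ x → x ∈ Σ₁ ⊎ x ∈ Λ) →
             Σ′ ++ Θ ⊆ Σ₁ ++ Θ′
⊃∈-irr-lhs {Σ₁} eΘ′ eΣ′ =
  ++-⊆ (λ {x} → [ ∈-++⁺ˡ , ∈-++⁺ʳ Σ₁ ∘ proj₂ (eΘ′ x) ∘ inj₂ ]′ ∘ proj₁ (eΣ′ x))
       (λ {x} → ∈-++⁺ʳ Σ₁ ∘ proj₂ (eΘ′ x) ∘ inj₁)

module _ {m} (Σs Θs : Fin (suc m) → List Fm) (As : Fin (suc m) → Fm) where
  open JoinData Σs Θs As

  private
    ∃Σ⇒lhs : JoinCond → ∀ j {x} → ∃[ i ] (x ∈ Σs i) → x ∈ Σs j ++ Θs j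
    ∃Σ⇒lhs cond j (i , x∈Σi) with i ≟ᶠⁱⁿ j
    ... | yes refl = ∈-++⁺ˡ x∈Σi
    ... | no i≢j = proj₁ cond i j i≢j x∈Σi

    ∀Θ⇒lhs : ∀ j {x} → (∀ i → x ∈ Θs i) → x ∈ Σs j ++ Θs j
    ∀Θ⇒lhs j x∈Θ = ∈-++⁺ʳ (Σs j) (x∈Θ j)

  join-at-lhs : ∀ {Γ F} → JoinCond → Γ ≐ (λ x → ΣAt x ⊎ (ΘAt x × x ≢ F) ⊎ ΣImp x ⊎ ΘImp x) →
                ∀ j → Γ ⊆ Σs j ++ Θs j
  join-at-lhs cond eΓ j {x} x∈Γ with proj₁ (eΓ x) x∈Γ
  ... | inj₁ (x∈Σ , _) = ∃Σ⇒lhs cond j x∈Σ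
  ... | inj₂ (inj₁ ((x∈Θ , _) , _)) = ∀Θ⇒lhs j x∈Θ
  ... | inj₂ (inj₂ (inj₁ (x∈Σ , _))) = ∃Σ⇒lhs cond j x∈Σ
  ... | inj₂ (inj₂ (inj₂ (x∈Θ , _))) = ∀Θ⇒lhs j x∈Θ

  join-or-lhs : ∀ {Γ} → JoinCond → Γ ≐ (λ x → ΣAt x ⊎ ΘAt x ⊎ ΣImp x ⊎ ΘImp x) →
                ∀ j → Γ ⊆ Σs j ++ Θs j
  join-or-lhs cond eΓ j {x} x∈Γ with proj₁ (eΓ x) x∈Γ
  ... | inj₁ (x∈Σ , _) = ∃Σ⇒lhs cond j x∈Σ
  ... | inj₂ (inj₁ (x∈Θ , _)) = ∀Θ⇒lhs j x∈Θ
  ... | inj₂ (inj₂ (inj₁ (x∈Σ , _))) = ∃Σ⇒lhs cond j x∈Σ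
  ... | inj₂ (inj₂ (inj₂ (x∈Θ , _))) = ∀Θ⇒lhs j x∈Θ

axiom⇒pshaped : ∀ {G σ} → IsRegular σ → IsAxiom G σ → PShaped σ
axiom⇒pshaped {σ = reg _ _} _ (_ , (ax-reg _ _ F∈𝒱⊥ _ , _) , (_ , refl)) = inj₁ F∈𝒱⊥

joinRule⇒pshaped : ∀ {G ps σ σ′} → JoinRule G ps σ′ → σ ≈S σ′ → PShaped σ
joinRule⇒pshaped {σ = reg _ _} (join-at _ _ _ _ _ _ F∈𝒱⊥ _ _ _) (_ , refl) = inj₁ F∈𝒱⊥
joinRule⇒pshaped {σ = reg _ _} (join-or _ _ _ _ C₁ C₂ _ _ _ _ _) (_ , refl) = inj₂ (C₁ , C₂ , refl)

joinOcc⇒pshaped : ∀ {G σ D} → JoinOcc G σ D → PShaped σ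
joinOccAny⇒pshaped : ∀ {G σ Ds} → JoinOccAny G σ Ds → PShaped σ
joinOcc⇒pshaped {D = node _ _} (inj₁ (σ≈ , rule)) = joinRule⇒pshaped rule σ≈
joinOcc⇒pshaped {D = node _ _} (inj₂ occ) = joinOccAny⇒pshaped occ
joinOccAny⇒pshaped {Ds = _ ∷ _} (inj₁ occ) = joinOcc⇒pshaped occ
joinOccAny⇒pshaped {Ds = _ ∷ _} (inj₂ occ) = joinOccAny⇒pshaped occ

pseq⇒pshaped : ∀ {G D σ} → PSeq G D σ → PShaped σ
pseq⇒pshaped (σ-reg , _ , inj₁ axiom) = axiom⇒pshaped σ-reg axiom
pseq⇒pshaped (_ , _ , inj₂ occ) = joinOcc⇒pshaped occ

wchain-end : ∀ {G D ρ k w} → PSeq G D ρ → WChain G D ρ k w → PSeq G D w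
wchain-end ρ-pseq start = ρ-pseq
wchain-end _ (step _ w-pseq _) = w-pseq

-- The potential of a sequent of FRJ(G)

module Measures (G : Fm) where

  N : ℕ
  N = size G

  clCount : Seq → ℕ
  clCount σ = length (filter (Cl? (Lhs σ)) (subs G))

  clCount≤N : ∀ σ → clCount σ ≤ N
  clCount≤N σ = subst (clCount σ ≤_) (length-subs G) (length-filter (Cl? (Lhs σ)) (subs G))

  clCount-mono : ∀ {σ τ} → Lhs σ ⊆Cl Lhs τ → clCount σ ≤ clCount τ
  clCount-mono {σ} {τ} σ⊆τ = length-filter-mono (Cl? (Lhs σ)) (Cl? (Lhs τ)) (Cl-mono σ⊆τ) (subs G)

  clCount-mono-< : ∀ {σ τ A} → Lhs σ ⊆Cl Lhs τ → A ∈ subs G →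
                   Cl (InL (Lhs τ)) A → ¬ Cl (InL (Lhs σ)) A → clCount σ < clCount τ
  clCount-mono-< {σ} {τ} σ⊆τ =
    length-filter-mono-< (Cl? (Lhs σ)) (Cl? (Lhs τ)) (Cl-mono σ⊆τ) (subs G)

  clCount-≈ : ∀ {σ τ} → σ ≈S τ → clCount σ ≡ clCount τ
  clCount-≈ {σ} {τ} σ≈τ = ≤-antisym (clCount-mono {σ} {τ} (⊆⇒⊆Cl (≈S-lhs σ≈τ)))
                                    (clCount-mono {τ} {σ} (⊆⇒⊆Cl (≈S-lhs (≈S-sym σ≈τ))))

  -- For sequents of FRJ(G), any regular sequent outweighs any irregular one.
  weight : Seq → ℕ
  weight (reg _ C) = suc (N + size C)
  weight (irr _ _ C) = size C

  K : ℕ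
  K = suc (suc (N + N))

  weight<K : ∀ {σ} → size (Rhs σ) ≤ N → weight σ < K
  weight<K {reg _ _} C≤N = s≤s (s≤s (+-monoʳ-≤ N C≤N))
  weight<K {irr _ _ _} C≤N = s≤s (m≤n⇒m≤1+n (≤-trans C≤N (m≤m+n N N)))

  weight-≈ : ∀ {σ τ} → σ ≈S τ → weight σ ≡ weight τ
  weight-≈ {reg _ _} {reg _ _} (_ , refl) = refl
  weight-≈ {irr _ _ _} {irr _ _ _} (_ , _ , refl) = refl

  potential : Seq → ℕ
  potential σ = (N ∸ clCount σ) * K + weight σ

  potential-≈ : ∀ {σ τ} → σ ≈S τ → potential σ ≡ potential τ
  potential-≈ σ≈τ = cong₂ (λ c w → (N ∸ c) * K + w) (clCount-≈ σ≈τ) (weight-≈ σ≈τ)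

  potential<bound : ∀ {σ} → size (Rhs σ) ≤ N → potential σ < suc N * K
  potential<bound {σ} C≤N = begin-strict
    (N ∸ clCount σ) * K + weight σ  ≤⟨ +-monoˡ-≤ (weight σ) (*-monoˡ-≤ K (m∸n≤m N (clCount σ))) ⟩
    N * K + weight σ                <⟨ +-monoʳ-< (N * K) (weight<K {σ} C≤N) ⟩
    N * K + K                       ≡⟨ +-comm (N * K) K ⟩
    suc N * K                       ∎
    where open ≤-Reasoning

  record Descent (τ σ : Seq) : Set where
    field
      clCount-≤ : clCount σ ≤ clCount τ
      clCount-< : IsRegular τ → IsIrregular σ → clCount σ < clCount τ
      potential-< : potential τ < potential σ
      pshaped⇒irregular : PShaped σ → IsIrregular τ

  open Descent

  regular-descent : ∀ {Γ B C} → size B < size C → ¬ AtomicOrDisjunction C →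
                    Descent (reg Γ B) (reg Γ C)
  regular-descent {Γ} {B} B<C ¬shaped = record
    { clCount-≤ = ≤-refl
    ; clCount-< = λ _ ()
    ; potential-< = lex-<ʳ (≤-refl {N ∸ clCount (reg Γ B)}) (s≤s (+-monoʳ-< N B<C))
    ; pshaped⇒irregular = ⊥-elim ∘ ¬shaped
    }

  irregular-descent : ∀ {S T B S′ T′ C} → S′ ++ T′ ⊆ S ++ T → size B < size C →
                      Descent (irr S T B) (irr S′ T′ C)
  irregular-descent {S} {T} {B} {S′} {T′} {C} lhs⊆ B<C = record
    { clCount-≤ = clCount≤
    ; clCount-< = λ ()
    ; potential-< = lex-<ʳ (∸-monoʳ-≤ N clCount≤) B<C
    ; pshaped⇒irregular = λ ()
    }
    where
    clCount≤ : clCount (irr S′ T′ C) ≤ clCount (irr S T B)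
    clCount≤ = clCount-mono {irr S′ T′ C} {irr S T B} (⊆⇒⊆Cl lhs⊆)

  join-descent : ∀ {S T A Γ C} → Γ ⊆ S ++ T → size A ≤ N →
                 Descent (irr S T A) (reg Γ C)
  join-descent {S} {T} {A} {Γ} {C} lhs⊆ A≤N = record
    { clCount-≤ = clCount≤
    ; clCount-< = λ ()
    ; potential-< = lex-<ʳ (∸-monoʳ-≤ N clCount≤) (s≤s (≤-trans A≤N (m≤m+n N (size C))))
    ; pshaped⇒irregular = λ _ → tt
    }
    where
    clCount≤ : clCount (reg Γ C) ≤ clCount (irr S T A)
    clCount≤ = clCount-mono {reg Γ C} {irr S T A} (⊆⇒⊆Cl lhs⊆)

  ⊃∉-descent : ∀ {Γ B Θ A C} → Θ ⊆Cl Γ → A ∈ subs G → Cl (InL Γ) A → ¬ Cl (InL Θ) A →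
               size B ≤ N → Descent (reg Γ B) (irr [] Θ C)
  ⊃∉-descent {Γ} {B} {Θ} {A} {C} lhs⊆ A∈G ΓA ¬ΘA B≤N = record
    { clCount-≤ = <⇒≤ clCount<
    ; clCount-< = λ _ _ → clCount<
    ; potential-< = lex-<ˡ (weight<K {reg Γ B} B≤N) (∸-monoʳ-< clCount< (clCount≤N (reg Γ B)))
    ; pshaped⇒irregular = λ ()
    }
    where
    clCount< : clCount (irr [] Θ C) < clCount (reg Γ B)
    clCount< = clCount-mono-< {irr [] Θ C} {reg Γ B} lhs⊆ A∈G ΓA ¬ΘA

  rule⇒descent : ∀ {ps σ p} → Rule G ps σ → All (WF G) ps → WF G σ → p ∈ ps → Descent p σ
  rule⇒descent (∧₁-reg _ _ _) _ _ (here refl) =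
    regular-descent (s≤s (m≤m+n _ _)) ¬AtomicOrDisjunction-∧
  rule⇒descent (∧₂-reg _ _ _) _ _ (here refl) =
    regular-descent (s≤s (m≤n+m _ _)) ¬AtomicOrDisjunction-∧
  rule⇒descent (∧₁-irr _ _ _ _) _ _ (here refl) = irregular-descent id (s≤s (m≤m+n _ _))
  rule⇒descent (∧₂-irr _ _ _ _) _ _ (here refl) = irregular-descent id (s≤s (m≤n+m _ _))
  rule⇒descent (∨-irr _ _ _ _ _ _ _ _ _ Σ₂⊆ eΣ eΘ) _ _ (here refl) =
    irregular-descent (∨-irr-lhs Σ₂⊆ (λ {x} → proj₁ (eΣ x)) (λ {x} → proj₁ ∘ proj₁ (eΘ x)))
                      (s≤s (m≤m+n _ _))
  rule⇒descent (∨-irr _ _ _ _ _ _ _ _ Σ₁⊆ _ eΣ eΘ) _ _ (there (here refl)) =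
    irregular-descent (∨-irr-lhs Σ₁⊆ (λ {x} → swap ∘ proj₁ (eΣ x)) (λ {x} → proj₂ ∘ proj₁ (eΘ x)))
                      (s≤s (m≤n+m _ _))
  rule⇒descent (⊃∈-reg _ _ _ _) _ _ (here refl) =
    regular-descent (s≤s (m≤n+m _ _)) ¬AtomicOrDisjunction-⊃
  rule⇒descent (⊃∈-irr _ _ _ _ _ _ _ eΘ′ _ _ _ eΣ′) _ _ (here refl) =
    irregular-descent (⊃∈-irr-lhs eΘ′ eΣ′) (s≤s (m≤n+m _ _))
  rule⇒descent (⊃∉ _ _ _ _ Θ⊆ ΓA ¬ΘA _) (wfp All.∷ _) wfσ (here refl) =
    ⊃∉-descent (proj₁ ∘ Θ⊆) (Sl⇒∈subs (sr-⊃ (proj₂ wfσ))) ΓA ¬ΘA (Sr⇒size-≤ (proj₂ wfp))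
  rule⇒descent (join (join-at Σs Θs As _ _ cond _ _ _ eΓ)) wfs _ p∈
    with ∈-tabulate⁻ {f = λ j → irr (Σs j) (Θs j) (As j)} p∈
  ... | j , refl =
    join-descent (join-at-lhs Σs Θs As cond eΓ j) (Sr⇒size-≤ (proj₂ (All.lookup wfs p∈)))
  rule⇒descent (join (join-or Σs Θs As _ _ _ cond _ _ _ eΓ)) wfs _ p∈
    with ∈-tabulate⁻ {f = λ j → irr (Σs j) (Θs j) (As j)} p∈
  ... | j , refl =
    join-descent (join-or-lhs Σs Θs As cond eΓ j) (Sr⇒size-≤ (proj₂ (All.lookup wfs p∈)))

  descent-≈ : ∀ {τ τ′ σ σ′} → τ ≈S τ′ → σ ≈S σ′ → Descent τ′ σ′ → Descent τ σ
  descent-≈ {τ} {τ′} {σ} {σ′} τ≈τ′ σ≈σ′ d = record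
    { clCount-≤ = subst₂ _≤_ σ′≡σ τ′≡τ (clCount-≤ d)
    ; clCount-< = λ τ-reg σ-irr → subst₂ _<_ σ′≡σ τ′≡τ
        (clCount-< d (≈S-regular {τ} τ≈τ′ τ-reg) (≈S-irregular {σ} σ≈σ′ σ-irr))
    ; potential-< = subst₂ _<_ (sym (potential-≈ {τ} τ≈τ′)) (sym (potential-≈ {σ} σ≈σ′))
                           (potential-< d)
    ; pshaped⇒irregular = ≈S-irregular {τ′} (≈S-sym {τ} τ≈τ′) ∘ pshaped⇒irregular d
                         ∘ ≈S-pshaped {σ} σ≈σ′
    }
    where
    σ′≡σ : clCount σ′ ≡ clCount σ
    σ′≡σ = sym (clCount-≈ {σ} σ≈σ′)
    τ′≡τ : clCount τ′ ≡ clCount τ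
    τ′≡τ = sym (clCount-≈ {τ} τ≈τ′)

  step⇒descent : ∀ {τ σ} → Step G τ σ → Descent τ σ
  step⇒descent {τ} {σ} (_ , σ′ , (rule , wfs , wfσ′) , σ≈σ′ , τ≈premise) with find τ≈premise
  ... | p , p∈ps , τ≈p = descent-≈ {τ} {p} {σ} {σ′} τ≈p σ≈σ′ (rule⇒descent rule wfs wfσ′ p∈ps)

  step⇒rhs≤N : ∀ {τ σ} → Step G τ σ → size (Rhs σ) ≤ N
  step⇒rhs≤N {σ = σ} (_ , σ′ , (_ , _ , wfσ′) , σ≈σ′ , _) =
    subst (λ C → size C ≤ N) (sym (≈S-rhs {σ} σ≈σ′)) (Sr⇒size-≤ (proj₂ wfσ′))

  reach-rhs≤N : ∀ {τ σ} → Reach G τ σ → size (Rhs σ) ≤ N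
  reach-rhs≤N [ s ] = step⇒rhs≤N s
  reach-rhs≤N (_ ∷ʳ s) = step⇒rhs≤N s

  reach-potential : ∀ {τ σ} → Reach G τ σ → potential τ < potential σ
  reach-potential [ s ] = potential-< (step⇒descent s)
  reach-potential (r ∷ʳ s) = <-trans (reach-potential r) (potential-< (step⇒descent s))

  reach-clCount-≤ : ∀ {τ σ} → Reach G τ σ → clCount σ ≤ clCount τ
  reach-clCount-≤ [ s ] = clCount-≤ (step⇒descent s)
  reach-clCount-≤ (r ∷ʳ s) = ≤-trans (clCount-≤ (step⇒descent s)) (reach-clCount-≤ r)

  reach-clCount-< : ∀ {τ σ} → Reach G τ σ → IsRegular τ → IsIrregular σ → clCount σ < clCount τ
  reach-clCount-< [ s ] = clCount-< (step⇒descent s)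
  reach-clCount-< (_∷ʳ_ {σ₂ = υ} r s) τ-reg σ-irr with υ
  ... | reg _ _ = <-≤-trans (clCount-< (step⇒descent s) tt σ-irr) (reach-clCount-≤ r)
  ... | irr _ _ _ = ≤-<-trans (clCount-≤ (step⇒descent s)) (reach-clCount-< r τ-reg tt)

  reach-pshaped : ∀ {τ σ} → Reach G τ σ → IsRegular τ → PShaped σ → clCount σ < clCount τ
  reach-pshaped {τ} [ s ] τ-reg σ-shaped =
    ⊥-elim (regular⇒¬irregular {τ} τ-reg (pshaped⇒irregular (step⇒descent s) σ-shaped))
  reach-pshaped (r ∷ʳ s) τ-reg σ-shaped = ≤-<-trans (clCount-≤ (step⇒descent s))
    (reach-clCount-< r τ-reg (pshaped⇒irregular (step⇒descent s) σ-shaped))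

  hchain-potential : ∀ {D k σ} → HChain G D k σ → k ≤ potential σ
  hchain-potential (start _) = z≤n
  hchain-potential (step h r _ _) = ≤-trans (s≤s (hchain-potential h)) (reach-potential r)

  hchain-length : ∀ {D k σ} → HChain G D k σ → k ≤ 8 * N * N
  hchain-length h = <⇒≤ (<-≤-trans (hchain-bounded h) (quadratic-bound (1≤size G)))
    where
    hchain-bounded : ∀ {D k σ} → HChain G D k σ → k < suc N * K
    hchain-bounded (start _) = z<s
    hchain-bounded {σ = σ} h@(step _ r _ _) =
      ≤-<-trans (hchain-potential h) (potential<bound {σ} (reach-rhs≤N r))

  wchain-length : ∀ {D ρ k w} → PSeq G D ρ → WChain G D ρ k w → k ≤ clCount w
  wchain-length _ start = z≤n
  wchain-length {w = w′} _ (step _ _ (inj₁ w′≈w , w≉w′)) = ⊥-elim (w≉w′ (≈S-sym {w′} w′≈w))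
  wchain-length ρ-pseq (step ch w′-pseq (inj₂ w′↦w , _)) = ≤-trans
    (s≤s (wchain-length ρ-pseq ch))
    (reach-pshaped w′↦w (proj₁ w′-pseq) (pseq⇒pshaped (wchain-end ρ-pseq ch)))

theorem3p14 :
    (∃[ c ] (∀ (G : Fm) (D : Tree) → Valid G D → HeightLe G D (c * size G * size G)))
    × (∀ (G : Fm) (D : Tree) → Valid G D → IsDerivationOf G D → ModHeightLe G D (size G))
theorem3p14 =
  (8 , λ G D _ k → Measures.hchain-length G) ,
  λ G D _ _ ρ (ρ-pseq , _) k w chain →
    ≤-trans (Measures.wchain-length G ρ-pseq chain) (Measures.clCount≤N G w)
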